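{- For any term $u$ and substitution $\sigma$: if $u\rightsquigarrow u'$ (general reduction), then $u[\sigma]\rightsquigarrow u'[\sigma]$.
   Context: Raw syntax of $\mathrm{Catt}_{\mathrm{su}}$. Fix an infinite set $V$ of variables containing distinct $d_i,d_i'$ ($i\in\mathbb N$). Contexts $\Gamma::=\emptyset\mid\Gamma,x:A$; types $A::=\star\mid s\to_A t$; terms $t::=x\mid\mathsf{coh}(\Gamma:A)[\sigma]$; substitutions $\sigma::=\langle\rangle\mid\langle\sigma,x\mapsto t\rangle$ (also written $[s_1,\dots,s_n]$). $\equiv$ is syntactic equality up to $\alpha$-equivalence. Substitution application: $\star[\sigma]=\star$, $(s\to_A t)[\sigma]=s[\sigma]\to_{A[\sigma]}t[\sigma]$, $x[\sigma]$ the entry of $\sigma$ for $x$, $\mathsf{coh}(\Gamma:A)[\tau][\sigma]=\mathsf{coh}(\Gamma:A)[\tau\circ\sigma]$, with $\langle\rangle\circ\sigma=\langle\rangle$, $\langle\tau,x\mapsto t\rangle\circ\sigma=\langle\tau\circ\sigma,x\mapsto t[\sigma]\rangle$. $\dim\star=-1$, $\dim(s\to_A t)=\dim A+1$. Pasting contexts are derived linearly by: $(x:\star)\vdash_p x:\star$; $\Gamma\vdash_p x:A\Rightarrow\Gamma,y:A,f:x\to_A y\vdash_p f:x\to_A y$ (introduction); $\Gamma\vdash_p f:x\to_A y\Rightarrow\Gamma\vdash_p y:A$ (descent); ending at a variable of type $\star$. Locally maximal variables: introduced by an introduction step immediately followed by a descent step. Discs: $D^0=(d_0:\star)$, $S^{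 -1}=\star$, $D^{k+1}=D^k,(d_k':S^{k-1}),(d_{k+1}:S^k)$, $S^k=d_k\to_{S^{k-1}}d_k'$; $\mathsf{i}_k:=\mathsf{coh}(D^k:d_k\to_{S^{k-1}}d_k)[\mathrm{id}_{D^k}]$; a term is an identity if syntactically of the form $\mathsf{i}_k[\tau]$. $\{\star,t\}=\langle t\rangle$, $\{u\to_A v,t\}=\langle\{A,u\},v,t\rangle$. For locally maximal $\alpha:s\to_A t$ of $\Delta$: $\Delta/\!\!/\alpha$ deletes $t,\alpha$; $\pi_\alpha$ sends $\alpha\mapsto\mathsf{i}_{\dim A+1}[\{A,s\}]$, $t\mapsto s$, others fixed; $\sigma/\!\!/\alpha$ removes the entries for $t,\alpha$. General reduction $\rightsquigarrow$ (simultaneous induction): $\star$ and variables do not reduce; $u\to_T v$ reduces to $u'\to_T v$, $u\to_T v'$ or $u\to_{T'}v$ whenever $u\rightsquigarrow u'$, $v\rightsquigarrow v'$ or $T\rightsquigarrow T'$; a substitution reduces by reducing any one entry; $t\equiv\mathsf{coh}(\Gamma:T)[\sigma]$ reduces via (A) $\sigma\rightsquigarrow\sigma'$ to $\mathsf{coh}(\Gamma:T)[\sigma']$; (B) if $t$ is not an identity and $x$ is a locally maximal variable of $\Gamma$ with $x[\sigma]$ an identity, to $\mathsf{coh}(\Gamma/\!\!/x:T[\pi_x])[\sigma/\!\!/x]$; (C) $T\rightsquigarrow T'$ to $\mathsf{coh}(\Gamma:T')[\sigma]$; (D) $\mathsf{coh}(D^{n+1}:S^n)[\dots,t']\rightsquigarrow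 t'$ (its last entry); (E) if $t$ is not an identity and $T\equiv u\to_{T_0}u$, to $\mathsf{i}_{\dim T_0+1}[\{T_0,u\}\circ\sigma]$. -}

module Defs where

-- Well-scoped (de Bruijn index) rendering of the raw syntax of Catt_su.
-- Variables are de Bruijn indices (var zero = most recently introduced
-- variable), so alpha-equivalence is syntactic equality _≡_.

open import Data.Nat using (ℕ; zero; suc)
open import Data.Fin using (Fin; zero; suc)
open import Data.Product using (Σ)
open import Relation.Binary.PropositionalEquality using (_≡_)
open import Relation.Nullary using (¬_)

infixl 5 _▸_
infix 6 _─⟨_⟩⟶_

mutual
  data Ctx : ℕ → Set where
    ∅   : Ctx 0
    _▸_ : ∀ {n} → Ctx n → Ty n → Ctx (suc n)

  data Ty (n : ℕ) : Set where
    ⋆       : Ty n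
    _─⟨_⟩⟶_ : Tm n → Ty n → Tm n → Ty n

  data Tm (n : ℕ) : Set where
    var : Fin n → Tm n
    coh : ∀ {m} → Ctx m → Ty m → Sub m n → Tm n

  -- substitutions σ ::= ⟨⟩ | ⟨σ , x ↦ t⟩ ; Sub m n assigns to each of the m
  -- variables of the source a term in scope n (last entry = var zero)
  data Sub : ℕ → ℕ → Set where
    ⟨⟩    : ∀ {n} → Sub 0 n
    ⟨_,_⟩ : ∀ {m n} → Sub m n → Tm n → Sub (suc m) n

lookupS : ∀ {m n} → Sub m n → Fin m → Tm n
lookupS ⟨ σ , t ⟩ zero    = t
lookupS ⟨ σ , t ⟩ (suc i) = lookupS σ i

mutual
  _[_]tm : ∀ {m n} → Tm m → Sub m n → Tm n
  var i       [ σ ]tm = lookupS σ i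
  coh Γ A τ   [ σ ]tm = coh Γ A (τ ∘s σ)

  _∘s_ : ∀ {k m n} → Sub k m → Sub m n → Sub k n
  ⟨⟩        ∘s σ = ⟨⟩
  ⟨ τ , t ⟩ ∘s σ = ⟨ τ ∘s σ , t [ σ ]tm ⟩

_[_]ty : ∀ {m n} → Ty m → Sub m n → Ty n
⋆             [ σ ]ty = ⋆
(s ─⟨ A ⟩⟶ t) [ σ ]ty = (s [ σ ]tm) ─⟨ A [ σ ]ty ⟩⟶ (t [ σ ]tm)

mutual
  wkTm : ∀ {n} → Tm n → Tm (suc n)
  wkTm (var i)     = var (suc i)
  wkTm (coh Γ A τ) = coh Γ A (wkSub τ)

  wkSub : ∀ {m n} → Sub m n → Sub m (suc n)
  wkSub ⟨⟩        = ⟨⟩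
  wkSub ⟨ τ , t ⟩ = ⟨ wkSub τ , wkTm t ⟩

wkTy : ∀ {n} → Ty n → Ty (suc n)
wkTy ⋆             = ⋆
wkTy (s ─⟨ A ⟩⟶ t) = wkTm s ─⟨ wkTy A ⟩⟶ wkTm t

liftS : ∀ {m n} → Sub m n → Sub (suc m) (suc n)
liftS σ = ⟨ wkSub σ , var zero ⟩

idSub : ∀ n → Sub n n
idSub zero    = ⟨⟩
idSub (suc n) = liftS (idSub n)

-- dim' A = dim A + 1  (so dim ⋆ = -1 corresponds to dim' ⋆ = 0)
dim' : ∀ {n} → Ty n → ℕ
dim' ⋆             = 0
dim' (s ─⟨ A ⟩⟶ t) = suc (dim' A)

twice : ℕ → ℕ
twice zero    = zero
twice (suc k) = suc (suc (twice k))

dsz : ℕ → ℕ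
dsz k = suc (twice k)

mutual
  -- bdry k = S^{k-1}, a type in the scope of D^k (d_k : S^{k-1})
  bdry : (k : ℕ) → Ty (dsz k)
  bdry zero    = ⋆
  bdry (suc k) = wkTy (sph k)

  -- sph k = S^k = d_k →_{S^{k-1}} d_k', in the scope of D^k , (d_k' : S^{k-1})
  sph : (k : ℕ) → Ty (suc (dsz k))
  sph k = var (suc zero) ─⟨ wkTy (bdry k) ⟩⟶ var zero

-- D^0 = (d_0 : ⋆),  D^{k+1} = D^k , (d_k' : S^{k-1}) , (d_{k+1} : S^k)
disc : (k : ℕ) → Ctx (dsz k)
disc zero    = ∅ ▸ ⋆
disc (suc k) = disc k ▸ bdry k ▸ sph k

ident : (k : ℕ) → Tm (dsz k)
ident k = coh (disc k) (var zero ─⟨ bdry k ⟩⟶ var zero) (idSub (dsz k))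

IsIdentity : ∀ {n} → Tm n → Set
IsIdentity {n} t = Σ ℕ λ k → Σ (Sub (dsz k) n) λ τ → t ≡ ident k [ τ ]tm

discSub : ∀ {n} (A : Ty n) → Tm n → Sub (dsz (dim' A)) n
discSub ⋆             t = ⟨ ⟨⟩ , t ⟩
discSub (u ─⟨ A ⟩⟶ v) t = ⟨ ⟨ discSub A u , v ⟩ , t ⟩

infix 4 _⊢p_∶_
data _⊢p_∶_ : ∀ {n} → Ctx n → Fin n → Ty n → Set where
  pbase  : (∅ ▸ ⋆) ⊢p zero ∶ ⋆
  pintro : ∀ {n} {Γ : Ctx n} {x A} → Γ ⊢p x ∶ A →
           (Γ ▸ A ▸ (var (suc x) ─⟨ wkTy A ⟩⟶ var zero))
             ⊢p zero ∶ wkTy (var (suc x) ─⟨ wkTy A ⟩⟶ var zero)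
  pdesc  : ∀ {n} {Γ : Ctx n} {f s A y} → Γ ⊢p f ∶ (s ─⟨ A ⟩⟶ var y) → Γ ⊢p y ∶ A

-- LM d i : the variable i is locally maximal in the derivation d, i.e. it was
-- introduced by an introduction step immediately followed by a descent step.
-- (Its target is then the variable suc i.)
data LM : ∀ {m} {Γ : Ctx (suc (suc m))} {z B} → Γ ⊢p z ∶ B → Fin (suc (suc m)) → Set where
  here        : ∀ {m} {Γ : Ctx m} {x A} (d : Γ ⊢p x ∶ A) → LM (pdesc (pintro d)) zero
  under-intro : ∀ {m} {Γ : Ctx (suc (suc m))} {x A i} {d : Γ ⊢p x ∶ A} →
                LM d i → LM (pintro d) (suc (suc i))
  under-desc  : ∀ {m} {Γ : Ctx (suc (suc m))} {f s A y i} {d : Γ ⊢p f ∶ (s ─⟨ A ⟩⟶ var y)} →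
                LM d i → LM (pdesc d) i

-- π_α : Δ → Δ//α  (α ↦ i_{dim A+1}[{A,s}], t ↦ s, others fixed)
πLM : ∀ {m} {Γ : Ctx (suc (suc m))} {z B} {d : Γ ⊢p z ∶ B} {i} → LM d i → Sub (suc (suc m)) m
πLM (here {m} {x = x} {A = A} d) = ⟨ ⟨ idSub m , var x ⟩ , ident (dim' A) [ discSub A (var x) ]tm ⟩
πLM (under-intro p)              = liftS (liftS (πLM p))
πLM (under-desc p)               = πLM p

-- Δ//α : delete t and α (later occurrences of t are replaced by s, i.e. the
-- remaining types are transported along π_α)
ctx// : ∀ {m} {Γ : Ctx (suc (suc m))} {z B} {d : Γ ⊢p z ∶ B} {i} → LM d i → Ctx m
ctx// (here {Γ = Γ} d)                   = Γ
ctx// (under-intro {x = x} {A = A} p)    =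
  ctx// p ▸ (A [ πLM p ]ty) ▸ ((var (suc x) ─⟨ wkTy A ⟩⟶ var zero) [ liftS (πLM p) ]ty)
ctx// (under-desc p)                     = ctx// p

sub// : ∀ {m n} {Γ : Ctx (suc (suc m))} {z B} {d : Γ ⊢p z ∶ B} {i} → LM d i → Sub (suc (suc m)) n → Sub m n
sub// (here d)        ⟨ ⟨ σ , _ ⟩ , _ ⟩ = σ
sub// (under-intro p) ⟨ ⟨ σ , a ⟩ , b ⟩ = ⟨ ⟨ sub// p σ , a ⟩ , b ⟩
sub// (under-desc p)  σ                 = sub// p σ

infix 4 _⇝tm_ _⇝ty_ _⇝s_
mutual
  data _⇝ty_ {n} : Ty n → Ty n → Set where
    ty-src : ∀ {u u' T v} → u ⇝tm u' → (u ─⟨ T ⟩⟶ v) ⇝ty (u' ─⟨ T ⟩⟶ v)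
    ty-tgt : ∀ {u T v v'} → v ⇝tm v' → (u ─⟨ T ⟩⟶ v) ⇝ty (u ─⟨ T ⟩⟶ v')
    ty-bas : ∀ {u T T' v} → T ⇝ty T' → (u ─⟨ T ⟩⟶ v) ⇝ty (u ─⟨ T' ⟩⟶ v)

  data _⇝s_ : ∀ {m n} → Sub m n → Sub m n → Set where
    s-tail : ∀ {m n} {σ σ' : Sub m n} {t} → σ ⇝s σ' → ⟨ σ , t ⟩ ⇝s ⟨ σ' , t ⟩
    s-head : ∀ {m n} {σ : Sub m n} {t t'} → t ⇝tm t' → ⟨ σ , t ⟩ ⇝s ⟨ σ , t' ⟩

  data _⇝tm_ {n} : Tm n → Tm n → Set where
    rA : ∀ {m} {Γ : Ctx m} {T} {σ σ' : Sub m n} → σ ⇝s σ' → coh Γ T σ ⇝tm coh Γ T σ'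
    rB : ∀ {m} {Γ : Ctx (suc (suc m))} {T} {σ : Sub (suc (suc m)) n} {z} {d : Γ ⊢p z ∶ ⋆} {i}
         (p : LM d i) → ¬ IsIdentity (coh Γ T σ) → IsIdentity (lookupS σ i) →
         coh Γ T σ ⇝tm coh (ctx// p) (T [ πLM p ]ty) (sub// p σ)
    rC : ∀ {m} {Γ : Ctx m} {T T'} {σ : Sub m n} → T ⇝ty T' → coh Γ T σ ⇝tm coh Γ T' σ
    rD : ∀ {k} {σ : Sub (suc (dsz k)) n} {t} → coh (disc (suc k)) (bdry (suc k)) ⟨ σ , t ⟩ ⇝tm t
    rE : ∀ {m} {Γ : Ctx m} {u T₀} {σ : Sub m n} →
         ¬ IsIdentity (coh Γ (u ─⟨ T₀ ⟩⟶ u) σ) →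
         coh Γ (u ─⟨ T₀ ⟩⟶ u) σ ⇝tm ident (dim' T₀) [ discSub T₀ u ∘s σ ]tm

module Submission where

-- The congruence rules (A), (C) and the pruning rule (D)
-- commute with substitution on the nose, because σ acts on a coherence
-- only through the composite of its argument substitution.  Rules (B) and
-- (E) need three facts about the substitution calculus, established first:
--   * composition of substitutions is associative and lookup commutes with
--     it, so (t[τ])[σ] ≡ t[τ ∘ σ];
--   * being an identity is preserved by substitution, and whether a
--     coherence coh(Γ : T)[τ] is an identity does not depend on τ, so the
--     side condition "not an identity" survives substitution;
--   * removing the entries of a locally maximal variable commutes with
--     composition: (τ//α) ∘ σ ≡ (τ ∘ σ)//α.

open import Defs
open import Data.Nat using (zero; suc)
open import Data.Fin using (Fin; zero; suc)
open import Data.Product using (_,_)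
open import Relation.Binary.PropositionalEquality
  using (_≡_; refl; sym; trans; cong; cong₂; subst; module ≡-Reasoning)
open import Relation.Nullary using (¬_)

lookup-∘ : ∀ {k m n} (τ : Sub k m) (σ : Sub m n) (i : Fin k) →
           lookupS (τ ∘s σ) i ≡ lookupS τ i [ σ ]tm
lookup-∘ ⟨ τ , t ⟩ σ zero    = refl
lookup-∘ ⟨ τ , t ⟩ σ (suc i) = lookup-∘ τ σ i

-- A weakened term does not mention the newest variable, so substituting into
-- it ignores the last entry of the substitution.
mutual
  wkTm-[,] : ∀ {m n} (t : Tm m) (σ : Sub m n) (s : Tm n) →
             wkTm t [ ⟨ σ , s ⟩ ]tm ≡ t [ σ ]tm
  wkTm-[,] (var i)     σ s = refl
  wkTm-[,] (coh Γ A τ) σ s = cong (coh Γ A) (wkSub-∘, τ σ s)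

  wkSub-∘, : ∀ {k m n} (τ : Sub k m) (σ : Sub m n) (s : Tm n) →
             wkSub τ ∘s ⟨ σ , s ⟩ ≡ τ ∘s σ
  wkSub-∘, ⟨⟩        σ s = refl
  wkSub-∘, ⟨ τ , t ⟩ σ s = cong₂ ⟨_,_⟩ (wkSub-∘, τ σ s) (wkTm-[,] t σ s)

idSub-∘ : ∀ {m n} (τ : Sub m n) → idSub m ∘s τ ≡ τ
idSub-∘ ⟨⟩        = refl
idSub-∘ ⟨ τ , t ⟩ =
  cong (λ ρ → ⟨ ρ , t ⟩) (trans (wkSub-∘, (idSub _) τ t) (idSub-∘ τ))

mutual
  [∘]tm : ∀ {k m n} (t : Tm k) (ρ : Sub k m) (σ : Sub m n) →
          t [ ρ ]tm [ σ ]tm ≡ t [ ρ ∘s σ ]tm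
  [∘]tm (var i)     ρ σ = sym (lookup-∘ ρ σ i)
  [∘]tm (coh Γ A τ) ρ σ = cong (coh Γ A) (∘s-assoc τ ρ σ)

  ∘s-assoc : ∀ {j k m n} (τ : Sub j k) (ρ : Sub k m) (σ : Sub m n) →
             (τ ∘s ρ) ∘s σ ≡ τ ∘s (ρ ∘s σ)
  ∘s-assoc ⟨⟩        ρ σ = refl
  ∘s-assoc ⟨ τ , t ⟩ ρ σ = cong₂ ⟨_,_⟩ (∘s-assoc τ ρ σ) ([∘]tm t ρ σ)

isIdentity-[] : ∀ {n n'} {t : Tm n} (σ : Sub n n') →
                IsIdentity t → IsIdentity (t [ σ ]tm)
isIdentity-[] σ (k , ρ , refl) = k , ρ ∘s σ , [∘]tm (ident k) ρ σ

-- Whether coh(Γ : T)[τ] is an identity depends only on Γ and T: if it is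
-- one, then Γ = D^k and T = (d_k → d_k), and every coh(D^k : d_k → d_k)[τ']
-- equals i_k[τ'] since id ∘ τ' ≡ τ'.
cohIdentity-anySub : ∀ {m n n'} {Γ : Ctx m} {T : Ty m} {τ : Sub m n} →
                     IsIdentity (coh Γ T τ) → (τ' : Sub m n') → IsIdentity (coh Γ T τ')
cohIdentity-anySub (k , ρ , refl) τ' = k , τ' , cong (coh _ _) (sym (idSub-∘ τ'))

nonIdentity-∘ : ∀ {m n n'} {Γ : Ctx m} {T : Ty m} (τ : Sub m n) (σ : Sub n n') →
                ¬ IsIdentity (coh Γ T τ) → ¬ IsIdentity (coh Γ T (τ ∘s σ))
nonIdentity-∘ τ σ notId isId = notId (cohIdentity-anySub isId τ)

sub//-∘ : ∀ {m n n'} {Γ : Ctx (suc (suc m))} {z B} {d : Γ ⊢p z ∶ B} {i}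
          (p : LM d i) (τ : Sub (suc (suc m)) n) (σ : Sub n n') →
          sub// p τ ∘s σ ≡ sub// p (τ ∘s σ)
sub//-∘ (here d)        ⟨ ⟨ τ , _ ⟩ , _ ⟩ σ = refl
sub//-∘ (under-intro p) ⟨ ⟨ τ , a ⟩ , b ⟩ σ =
  cong (λ ρ → ⟨ ⟨ ρ , a [ σ ]tm ⟩ , b [ σ ]tm ⟩) (sub//-∘ p τ σ)
sub//-∘ (under-desc p)  τ                 σ = sub//-∘ p τ σ

rB-∘ : ∀ {m n n'} {Γ : Ctx (suc (suc m))} {T : Ty (suc (suc m))} {z}
       {d : Γ ⊢p z ∶ ⋆} {i} (p : LM d i) (τ : Sub (suc (suc m)) n) (σ : Sub n n') →
       ¬ IsIdentity (coh Γ T τ) → IsIdentity (lookupS τ i) →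
       coh Γ T (τ ∘s σ) ⇝tm coh (ctx// p) (T [ πLM p ]ty) (sub// p τ ∘s σ)
rB-∘ {i = i} p τ σ notId varId
  rewrite sub//-∘ p τ σ =
    rB p (nonIdentity-∘ τ σ notId) varIdσ
  where
    varIdσ : IsIdentity (lookupS (τ ∘s σ) i)
    varIdσ = subst IsIdentity (sym (lookup-∘ τ σ i)) (isIdentity-[] σ varId)

rE-∘ : ∀ {m n n'} {Γ : Ctx m} {u : Tm m} {T₀ : Ty m} (τ : Sub m n) (σ : Sub n n') →
       ¬ IsIdentity (coh Γ (u ─⟨ T₀ ⟩⟶ u) τ) →
       coh Γ (u ─⟨ T₀ ⟩⟶ u) (τ ∘s σ) ⇝tm ident (dim' T₀) [ discSub T₀ u ∘s τ ]tm [ σ ]tm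
rE-∘ {Γ = Γ} {u} {T₀} τ σ notId =
  subst (coh Γ (u ─⟨ T₀ ⟩⟶ u) (τ ∘s σ) ⇝tm_) reduct-[σ] (rE (nonIdentity-∘ τ σ notId))
  where
    open ≡-Reasoning
    reduct-[σ] : ident (dim' T₀) [ discSub T₀ u ∘s (τ ∘s σ) ]tm
               ≡ ident (dim' T₀) [ discSub T₀ u ∘s τ ]tm [ σ ]tm
    reduct-[σ] = begin
      ident (dim' T₀) [ discSub T₀ u ∘s (τ ∘s σ) ]tm
        ≡⟨ cong (ident (dim' T₀) [_]tm) (sym (∘s-assoc (discSub T₀ u) τ σ)) ⟩
      ident (dim' T₀) [ (discSub T₀ u ∘s τ) ∘s σ ]tm
        ≡⟨ sym ([∘]tm (ident (dim' T₀)) (discSub T₀ u ∘s τ) σ) ⟩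
      ident (dim' T₀) [ discSub T₀ u ∘s τ ]tm [ σ ]tm
        ∎

mutual
  ⇝tm-[] : ∀ {m n} {u u' : Tm m} (σ : Sub m n) → u ⇝tm u' → u [ σ ]tm ⇝tm u' [ σ ]tm
  ⇝tm-[] σ (rA r)                          = rA (⇝s-∘ σ r)
  ⇝tm-[] σ (rB {σ = τ} p notId varId)      = rB-∘ p τ σ notId varId
  ⇝tm-[] σ (rC r)                          = rC r
  ⇝tm-[] σ rD                              = rD
  ⇝tm-[] {u = coh _ _ τ} σ (rE notId)      = rE-∘ τ σ notId

  ⇝s-∘ : ∀ {k m n} {τ τ' : Sub k m} (σ : Sub m n) → τ ⇝s τ' → τ ∘s σ ⇝s τ' ∘s σ
  ⇝s-∘ σ (s-tail r) = s-tail (⇝s-∘ σ r)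
  ⇝s-∘ σ (s-head r) = s-head (⇝tm-[] σ r)

mainTheorem16 : ∀ {m n} (u u' : Tm m) (σ : Sub m n) →
                u ⇝tm u' → (u [ σ ]tm) ⇝tm (u' [ σ ]tm)
mainTheorem16 u u' σ r = ⇝tm-[] σ r
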